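{- Let $(F_n)_{n\ge0}$ be the Fibonacci sequence ($F_0=0$, $F_1=1$, $F_{n+2}=F_{n+1}+F_n$). If $n$ and $x$ are natural numbers with $F_n=x(x+3)$, then $n\equiv 0\pmod{2800}$. -}

module Defs where

open import Data.Nat using (ℕ; zero; suc; _+_)

fib : ℕ → ℕ
fib zero = zero
fib (suc zero) = suc zero
fib (suc (suc n)) = fib (suc n) + fib n

-- Modulo m the pairs (F n, F (n+1)) run through a cycle, so F n mod m only depends on n mod a
-- period p of that cycle, while x (x + 3) mod m takes only some of the residues mod m.  For each
-- of fourteen moduli whose period divides 5600, this rules out a set of residues of n mod 5600,
-- and a finite check shows that every residue not divisible by 2800 is ruled out by one of them.

module Submission where

open import Defs
open import Data.Nat using (ℕ; zero; suc; _+_; _*_; _<_; NonZero; _≟_)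
open import Data.Nat.Properties using (+-comm; anyUpTo?; allUpTo?)
open import Data.Nat.DivMod
open import Data.Nat.Divisibility using (_∣_; _∣?_; divides; ∣n∣m%n⇒∣m)
open import Data.Nat.GeneralisedArithmetic using (fold; fold-+)
open import Data.Product using (_×_; _,_; proj₁; ∃)
open import Data.Empty using (⊥-elim)
open import Data.Sum using (_⊎_; inj₁; inj₂)
open import Data.List using (List; []; _∷_)
open import Data.List.Relation.Unary.Any using (Any; any?; satisfied)
open import Function.Base using (_∘_)
open import Level using (Level)
open import Relation.Nullary using (Dec; ¬_; ¬?)
open import Relation.Nullary.Decidable using (_⊎-dec_; from-yes)
open import Relation.Binary.PropositionalEquality
open ≡-Reasoning

module _ {a : Level} {A : Set a} (z : A) (s : A → A) {p : ℕ} (cycle : fold z s p ≡ z) where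

  fold-cycle-* : ∀ k → fold z s (k * p) ≡ z
  fold-cycle-* zero = refl
  fold-cycle-* (suc k) = begin
    fold z s (p + k * p)         ≡⟨ fold-+ z s p ⟩
    fold (fold z s (k * p)) s p  ≡⟨ cong (λ w → fold w s p) (fold-cycle-* k) ⟩
    fold z s p                   ≡⟨ cycle ⟩
    z                            ∎

  fold-cycle-% : .{{_ : NonZero p}} → ∀ n → fold z s n ≡ fold z s (n % p)
  fold-cycle-% n = begin
    fold z s n                               ≡⟨ cong (fold z s) (m≡m%n+[m/n]*n n p) ⟩
    fold z s (n % p + n / p * p)             ≡⟨ fold-+ z s (n % p) ⟩
    fold (fold z s (n / p * p)) s (n % p)
      ≡⟨ cong (λ w → fold w s (n % p)) (fold-cycle-* (n / p)) ⟩
    fold z s (n % p)                         ∎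

fibStep : (m : ℕ) .{{_ : NonZero m}} → ℕ × ℕ → ℕ × ℕ
fibStep m (a , b) = b , (a + b) % m

fibMod : (m : ℕ) .{{_ : NonZero m}} → ℕ → ℕ × ℕ
fibMod m = fold (0 % m , 1 % m) (fibStep m)

fibMod-fib : ∀ m .{{_ : NonZero m}} n → fibMod m n ≡ (fib n % m , fib (suc n) % m)
fibMod-fib m zero = refl
fibMod-fib m (suc n) = begin
  fibStep m (fibMod m n)                               ≡⟨ cong (fibStep m) (fibMod-fib m n) ⟩
  fib (suc n) % m , (fib n % m + fib (suc n) % m) % m  ≡⟨ cong (fib (suc n) % m ,_) fib-sum ⟩
  fib (suc n) % m , fib (suc (suc n)) % m              ∎
  where
  fib-sum : (fib n % m + fib (suc n) % m) % m ≡ (fib (suc n) + fib n) % m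
  fib-sum = trans (sym (%-distribˡ-+ (fib n) (fib (suc n)) m))
                  (%-congˡ (+-comm (fib n) (fib (suc n))))

[m+k]%n≡[m%n+k]%n : ∀ m k n .{{_ : NonZero n}} → (m + k) % n ≡ (m % n + k) % n
[m+k]%n≡[m%n+k]%n m k n = begin
  (m + k) % n              ≡⟨ %-distribˡ-+ m k n ⟩
  (m % n + k % n) % n      ≡⟨ cong (λ r → (r + k % n) % n) (sym (m%n%n≡m%n m n)) ⟩
  (m % n % n + k % n) % n  ≡⟨ sym (%-distribˡ-+ (m % n) k n) ⟩
  (m % n + k) % n          ∎

m*[m+k]%n≡[m%n]*[m%n+k]%n : ∀ m k n .{{_ : NonZero n}} →
                            m * (m + k) % n ≡ (m % n) * (m % n + k) % n
m*[m+k]%n≡[m%n]*[m%n+k]%n m k n = begin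
  m * (m + k) % n                          ≡⟨ %-distribˡ-* m (m + k) n ⟩
  (m % n) * ((m + k) % n) % n
    ≡⟨ cong₂ (λ r t → r * t % n) (sym (m%n%n≡m%n m n)) ([m+k]%n≡[m%n+k]%n m k n) ⟩
  (m % n % n) * ((m % n + k) % n) % n      ≡⟨ sym (%-distribˡ-* (m % n) (m % n + k) n) ⟩
  (m % n) * (m % n + k) % n                ∎

X[X+3]-residue : (m : ℕ) .{{_ : NonZero m}} → ℕ → Set
X[X+3]-residue m v = ∃ λ y → y < m × y * (y + 3) % m ≡ v

X[X+3]-residue? : ∀ m .{{_ : NonZero m}} v → Dec (X[X+3]-residue m v)
X[X+3]-residue? m v = anyUpTo? (λ y → y * (y + 3) % m ≟ v) m

record Sieve (N : ℕ) : Set where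
  constructor sieve
  field
    modulus period : ℕ
    {{modulus≢0}} : NonZero modulus
    {{period≢0}} : NonZero period
    cycle : fibMod modulus period ≡ fibMod modulus 0
    period∣N : period ∣ N

open Sieve

Rejects : ∀ {N} → Sieve N → ℕ → Set
Rejects s r = ¬ X[X+3]-residue (modulus s) (proj₁ (fibMod (modulus s) (r % period s)))

rejects? : ∀ {N} (s : Sieve N) r → Dec (Rejects s r)
rejects? s r = ¬? (X[X+3]-residue? (modulus s) _)

fib≡x[x+3]⇒¬Rejects : ∀ {N} .{{_ : NonZero N}} (s : Sieve N) n x →
                      fib n ≡ x * (x + 3) → ¬ Rejects s (n % N)
fib≡x[x+3]⇒¬Rejects {N} s n x fib≡ rejects = rejects (x % m , m%n<n x m , x%m-residue)
  where
  m = modulus s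
  p = period s
  x%m-residue : (x % m) * (x % m + 3) % m ≡ proj₁ (fibMod m (n % N % p))
  x%m-residue = begin
    (x % m) * (x % m + 3) % m       ≡⟨ sym (m*[m+k]%n≡[m%n]*[m%n+k]%n x 3 m) ⟩
    x * (x + 3) % m                 ≡⟨ %-congˡ (sym fib≡) ⟩
    fib n % m                       ≡⟨ cong proj₁ (sym (fibMod-fib m n)) ⟩
    proj₁ (fibMod m n)              ≡⟨ cong proj₁ (fold-cycle-% _ (fibStep m) (cycle s) n) ⟩
    proj₁ (fibMod m (n % p))
      ≡⟨ cong (proj₁ ∘ fibMod m) (sym (m∣n⇒o%n%m≡o%m p N n (period∣N s))) ⟩
    proj₁ (fibMod m (n % N % p))    ∎

sieves : List (Sieve 5600)
sieves =
    sieve 3 8 refl (divides 700 refl)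
  ∷ sieve 11 10 refl (divides 560 refl)
  ∷ sieve 5 20 refl (divides 280 refl)
  ∷ sieve 7 16 refl (divides 350 refl)
  ∷ sieve 13 28 refl (divides 200 refl)
  ∷ sieve 29 14 refl (divides 400 refl)
  ∷ sieve 47 32 refl (divides 175 refl)
  ∷ sieve 49 112 refl (divides 50 refl)
  ∷ sieve 101 50 refl (divides 112 refl)
  ∷ sieve 151 50 refl (divides 112 refl)
  ∷ sieve 401 200 refl (divides 28 refl)
  ∷ sieve 281 56 refl (divides 100 refl)
  ∷ sieve 1601 160 refl (divides 35 refl)
  ∷ sieve 2801 1400 refl (divides 4 refl)
  ∷ []

Sieved : ℕ → Set
Sieved r = 2800 ∣ r ⊎ Any (λ s → Rejects s r) sieves

sieved? : ∀ r → Dec (Sieved r)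
sieved? r = 2800 ∣? r ⊎-dec any? (λ s → rejects? s r) sieves

r<5600⇒Sieved : ∀ {r} → r < 5600 → Sieved r
r<5600⇒Sieved = from-yes (allUpTo? sieved? 5600)

lemma2 : (n x : ℕ) → fib n ≡ x * (x + 3) → 2800 ∣ n
lemma2 n x fib≡ = 2800∣n (r<5600⇒Sieved (m%n<n n 5600))
  where
  2800∣n : Sieved (n % 5600) → 2800 ∣ n
  2800∣n (inj₁ 2800∣n%5600) = ∣n∣m%n⇒∣m (divides 2 refl) 2800∣n%5600
  2800∣n (inj₂ rejected) with satisfied rejected
  ... | s , rejects = ⊥-elim (fib≡x[x+3]⇒¬Rejects s n x fib≡ rejects)
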